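{- Let $n,p$ be positive coprime integers and $\omega\in\widetilde{\mathfrak S}_n$ a dominant $p$-stable affine permutation. Then $t^p_{n+1-j,n+1-i}(\omega^*)=t^p_{i,j}(\omega)$ for all $i,j\in[n]$ with $i<j$; i.e. the rational Shi tableau of $\omega^*$ is the transpose of that of $\omega$.
   Context: $\widetilde{\mathfrak S}_n$ is the group of bijections $\omega:\mathbb Z\to\mathbb Z$ with $\omega(i+n)=\omega(i)+n$ and $\omega(1)+\dots+\omega(n)=n(n+1)/2$. $\omega$ is dominant if $\omega^{ -1}(1)<\dots<\omega^{ -1}(n)$, and $p$-stable if $\omega(i)<\omega(i+p)$ for all $i$. The involution $\omega^*$ is given by $\omega^*(i)=1-\omega(1-i)$; it maps dominant $p$-stable permutations to dominant $p$-stable permutations. For $i<j$ in $[n]$, $k_{i,j}(\omega)=|\lfloor(\omega^{ -1}(j)-\omega^{ -1}(i))/n\rfloor|$. Let $s\in\mathfrak S_n$ with $s(i)\in[n]$, $s(i)\equiv\omega^{ -1}(i)\pmod n$. Write $p=mn+r$ with $m\ge0$, $r\in[n-1]$ (for $n\ge 2$). The rational Shi tableau: $t^p_{i,j}(\omega)=\min(k_{i,j}(\omega),m)$ if $r+s(i)<s(j)$ or $s(i)+r-n<s(j)<s(i)$, and $\min(k_{i,j}(\omega),m+1)$ otherwise. -}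

module Defs where

open import Data.Nat as ℕ using (ℕ; zero; suc; NonZero)
open import Data.Integer as ℤ using (ℤ; +_; ∣_∣; _/ℕ_; _%ℕ_)
open import Data.Integer.Properties using () renaming (_<?_ to _<ℤ?_)
open import Data.Bool using (Bool; true; false; if_then_else_; _∨_; _∧_)
open import Relation.Nullary.Decidable using (⌊_⌋)
open import Relation.Binary.PropositionalEquality using (_≡_)

sumTo : (ℤ → ℤ) → ℕ → ℤ
sumTo f zero    = + 0
sumTo f (suc k) = sumTo f k ℤ.+ f (+ suc k)

-- An affine permutation in S̃_n: a bijection ℤ → ℤ (given with its
-- two-sided inverse), n-periodic, with ω(1)+…+ω(n) = n(n+1)/2
-- (stated as 2·Σ = n(n+1) to avoid division).
record AffinePerm (n : ℕ) : Set where
  field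
    fn       : ℤ → ℤ
    inv      : ℤ → ℤ
    inv-fn   : ∀ i → inv (fn i) ≡ i
    fn-inv   : ∀ i → fn (inv i) ≡ i
    periodic : ∀ i → fn (i ℤ.+ + n) ≡ fn i ℤ.+ + n
    sumCond  : + 2 ℤ.* sumTo fn n ≡ + (n ℕ.* suc n)
open AffinePerm public

Dominant : ∀ {n} → AffinePerm n → Set
Dominant {n} ω = ∀ i → 1 ℕ.≤ i → i ℕ.< n → inv ω (+ i) ℤ.< inv ω (+ suc i)

Stable : ∀ {n} → ℕ → AffinePerm n → Set
Stable p ω = ∀ i → fn ω i ℤ.< fn ω (i ℤ.+ + p)

star : (ℤ → ℤ) → ℤ → ℤ
star f i = + 1 ℤ.- f (+ 1 ℤ.- i)

-- k_{i,j}(ω) = | ⌊(ω^{-1}(j) - ω^{-1}(i)) / n⌋ |   (_/ℕ_ is floor division)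
kval : ∀ {n} .{{_ : NonZero n}} → AffinePerm n → ℕ → ℕ → ℕ
kval {n} ω i j = ∣ (inv ω (+ j) ℤ.- inv ω (+ i)) /ℕ n ∣

-- s(i) ∈ [n] with s(i) ≡ ω^{-1}(i) (mod n)
sval : ∀ {n} .{{_ : NonZero n}} → AffinePerm n → ℕ → ℕ
sval {n} ω i = suc ((inv ω (+ i) ℤ.- + 1) %ℕ n)

shiT : ∀ {n} .{{_ : NonZero n}} → ℕ → AffinePerm n → ℕ → ℕ → ℕ
shiT {n} p ω i j =
  if low then k ℕ.⊓ m else k ℕ.⊓ suc m
  where
    m = p ℕ./ n
    r = p ℕ.% n
    k = kval ω i j
    si = + sval ω i
    sj = + sval ω j
    low : Bool
    low = ⌊ (+ r ℤ.+ si) <ℤ? sj ⌋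
          ∨ (⌊ (si ℤ.+ + r ℤ.- + n) <ℤ? sj ⌋ ∧ ⌊ sj <ℤ? si ⌋)

-- ω* is ω conjugated by i ↦ 1-i, so by periodicity ω*⁻¹(n+1-i) = n+1 - ω⁻¹(i).
-- Hence the quotient k_{n+1-j,n+1-i}(ω*) sees the same difference ω⁻¹(j) - ω⁻¹(i)
-- as k_{i,j}(ω), and the residues transform as s*(n+1-i) = n+1 - s(i).  The test
-- choosing between the bounds m and m+1 depends on the pair (s(i), s(j)) only
-- through s(j) - s(i), which the reflection (s(i), s(j)) ↦ (n+1-s(j), n+1-s(i))
-- preserves.
module Submission where

open import Defs
open import Data.Nat using (ℕ; suc; _∸_; _≤_; _<_; NonZero)
open import Data.Nat.Coprimality using (Coprime)
open import Data.Integer using (ℤ)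
open import Relation.Binary.PropositionalEquality using (_≡_)

open import Data.Bool using (Bool; if_then_else_; _∨_; _∧_)
import Data.Nat as ℕ
import Data.Nat.Properties as ℕₚ
open import Data.Integer as ℤ using (+_; -_; _+_; _-_; _*_; _/ℕ_; _%ℕ_; ∣_∣)
open import Data.Integer.Properties as ℤₚ using (_<?_)
open import Data.Integer.DivMod using (a≡a%ℕn+[a/ℕn]*n; n%ℕd<d)
open import Data.Integer.Tactic.RingSolver using (solve-∀)
open import Data.Empty using (⊥-elim)
open import Function.Bundles using (_⇔_; mk⇔)
open import Relation.Nullary using (Dec)
open import Relation.Nullary.Decidable using (⌊_⌋; isYes≗does; does-⇔)
open import Relation.Binary.Definitions using (tri<; tri≈; tri>)
open import Relation.Binary.PropositionalEquality
  using (refl; sym; trans; cong; cong₂; subst₂; module ≡-Reasoning)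

+[m∸n]≡+m-+n : ∀ {m n} → n ℕ.≤ m → + (m ∸ n) ≡ + m - + n
+[m∸n]≡+m-+n {m} {n} n≤m = sym (trans (ℤₚ.m-n≡m⊖n m n) (ℤₚ.⊖-≥ n≤m))

[a+c]-c≡a : ∀ a c → a + c - c ≡ a
[a+c]-c≡a = solve-∀

+-cancelʳ-< : ∀ {a b} c → a + c ℤ.< b + c → a ℤ.< b
+-cancelʳ-< {a} {b} c a+c<b+c =
  subst₂ ℤ._<_ ([a+c]-c≡a a c) ([a+c]-c≡a b c) (ℤₚ.+-monoˡ-< (- c) a+c<b+c)

⌊⌋-⇔ : ∀ {A B : Set} → A ⇔ B → (a? : Dec A) (b? : Dec B) → ⌊ a? ⌋ ≡ ⌊ b? ⌋
⌊⌋-⇔ A⇔B a? b? = trans (isYes≗does a?) (trans (does-⇔ A⇔B a? b?) (sym (isYes≗does b?)))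

⌊<?⌋-translate : ∀ {a′ b′} a b c → a′ ≡ a + c → b′ ≡ b + c → ⌊ a′ <? b′ ⌋ ≡ ⌊ a <? b ⌋
⌊<?⌋-translate a b c refl refl = ⌊⌋-⇔ (mk⇔ (+-cancelʳ-< c) (ℤₚ.+-monoˡ-< c)) _ _

+t+k*n<+t′+q*n : ∀ {n t t′ k q} → t ℕ.< n → k ℤ.< q → + t + k * + n ℤ.< + t′ + q * + n
+t+k*n<+t′+q*n {n} {t} {t′} {k} {q} t<n k<q = begin-strict
  + t + k * + n    <⟨ ℤₚ.+-monoˡ-< (k * + n) (ℤ.+<+ t<n) ⟩
  + n + k * + n    ≡⟨ ℤₚ.suc-* k (+ n) ⟨
  ℤ.suc k * + n    ≤⟨ ℤₚ.*-monoʳ-≤-nonNeg (+ n) (ℤₚ.i<j⇒suc[i]≤j k<q) ⟩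
  q * + n          ≤⟨ ℤₚ.i≤j+i (q * + n) (+ t′) ⟩
  + t′ + q * + n   ∎
  where open ℤₚ.≤-Reasoning

remainder-unique : ∀ {n t t′} k q → t ℕ.< n → t′ ℕ.< n →
                   + t + k * + n ≡ + t′ + q * + n → t ≡ t′
remainder-unique {n} {t} {t′} k q t<n t′<n eq with ℤₚ.<-cmp k q
... | tri< k<q _ _ = ⊥-elim (ℤₚ.<-irrefl eq (+t+k*n<+t′+q*n t<n k<q))
... | tri> _ _ q<k = ⊥-elim (ℤₚ.<-irrefl (sym eq) (+t+k*n<+t′+q*n t′<n q<k))
... | tri≈ _ refl _ = ℤₚ.+-injective (begin
  + t                       ≡⟨ [a+c]-c≡a (+ t) (k * + n) ⟨
  + t + k * + n - k * + n   ≡⟨ cong (_- k * + n) eq ⟩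
  + t′ + k * + n - k * + n  ≡⟨ [a+c]-c≡a (+ t′) (k * + n) ⟩
  + t′                      ∎)
  where open ≡-Reasoning

[t+k*n]%ℕn≡t : ∀ n .{{_ : NonZero n}} t k → t ℕ.< n → (+ t + k * + n) %ℕ n ≡ t
[t+k*n]%ℕn≡t n t k t<n = remainder-unique (a /ℕ n) k (n%ℕd<d a n) t<n
  (sym (a≡a%ℕn+[a/ℕn]*n a n))
  where a = + t + k * + n

residue : (n : ℕ) .{{_ : NonZero n}} → ℤ → ℕ
residue n a = suc ((a - + 1) %ℕ n)

residue-reflect : ∀ n .{{_ : NonZero n}} a → + residue n (+ suc n - a) ≡ + suc n - + residue n a
residue-reflect n a = begin
  + suc ((+ suc n - a - + 1) %ℕ n)                 ≡⟨ cong (λ b → + suc (b %ℕ n)) reflected ⟩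
  + suc ((+ (n ∸ suc x) + (- q) * + n) %ℕ n)
    ≡⟨ cong (λ t → + suc t) ([t+k*n]%ℕn≡t n (n ∸ suc x) (- q) n∸suc[x]<n) ⟩
  + 1 + + (n ∸ suc x)                              ≡⟨ cong (λ b → + 1 + b) (+[m∸n]≡+m-+n x<n) ⟩
  + 1 + (+ n - + suc x)                            ≡⟨ 1+[N-Y]≡1+N-Y (+ n) (+ suc x) ⟩
  + suc n - + suc x                                ∎
  where
  open ≡-Reasoning
  x = (a - + 1) %ℕ n
  q = (a - + 1) /ℕ n
  x<n : suc x ℕ.≤ n
  x<n = n%ℕd<d (a - + 1) n
  n∸suc[x]<n : n ∸ suc x ℕ.< n
  n∸suc[x]<n = ℕₚ.∸-monoʳ-< {n} ℕ.z<s x<n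
  1+[N-Y]≡1+N-Y : ∀ N Y → + 1 + (N - Y) ≡ + 1 + N - Y
  1+[N-Y]≡1+N-Y = solve-∀
  1+N-a-1≡N-1-[a-1] : ∀ N a → + 1 + N - a - + 1 ≡ N - + 1 - (a - + 1)
  1+N-a-1≡N-1-[a-1] = solve-∀
  N-1-[X+QN]≡N-[1+X]+[-Q]N : ∀ N X Q → N - + 1 - (X + Q * N) ≡ N - (+ 1 + X) + (- Q) * N
  N-1-[X+QN]≡N-[1+X]+[-Q]N = solve-∀
  reflected : + suc n - a - + 1 ≡ + (n ∸ suc x) + (- q) * + n
  reflected = begin
    + suc n - a - + 1             ≡⟨ 1+N-a-1≡N-1-[a-1] (+ n) a ⟩
    + n - + 1 - (a - + 1)         ≡⟨ cong (λ b → + n - + 1 - b) (a≡a%ℕn+[a/ℕn]*n (a - + 1) n) ⟩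
    + n - + 1 - (+ x + q * + n)   ≡⟨ N-1-[X+QN]≡N-[1+X]+[-Q]N (+ n) (+ x) q ⟩
    + n - + suc x + (- q) * + n   ≡⟨ cong (_+ (- q) * + n) (+[m∸n]≡+m-+n x<n) ⟨
    + (n ∸ suc x) + (- q) * + n   ∎

inv-periodic : ∀ {n} (ω : AffinePerm n) y → inv ω (y - + n) ≡ inv ω y - + n
inv-periodic {n} ω y = begin
  inv ω (y - + n)             ≡⟨ cong (λ z → inv ω (z - + n)) fn-x+n≡y ⟨
  inv ω (fn ω x + + n - + n)  ≡⟨ cong (inv ω) ([a+c]-c≡a (fn ω x) (+ n)) ⟩
  inv ω (fn ω x)              ≡⟨ inv-fn ω x ⟩
  x                           ∎
  where
  open ≡-Reasoning
  x = inv ω y - + n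
  a-c+c≡a : ∀ a c → a - c + c ≡ a
  a-c+c≡a = solve-∀
  fn-x+n≡y : fn ω x + + n ≡ y
  fn-x+n≡y = begin
    fn ω x + + n                 ≡⟨ periodic ω x ⟨
    fn ω (inv ω y - + n + + n)   ≡⟨ cong (fn ω) (a-c+c≡a (inv ω y) (+ n)) ⟩
    fn ω (inv ω y)               ≡⟨ fn-inv ω y ⟩
    y                            ∎

module _ {n} (ω ω* : AffinePerm n) (ω*≗star : ∀ i → fn ω* i ≡ star (fn ω) i) where
  open ≡-Reasoning

  inv-star : ∀ x → inv ω* x ≡ star (inv ω) x
  inv-star x = begin
    inv ω* x                          ≡⟨ cong (inv ω*) fn*-star-inv≡x ⟨
    inv ω* (fn ω* (star (inv ω) x))   ≡⟨ inv-fn ω* (star (inv ω) x) ⟩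
    star (inv ω) x                    ∎
    where
    1-[1-a]≡a : ∀ a → + 1 - (+ 1 - a) ≡ a
    1-[1-a]≡a = solve-∀
    fn*-star-inv≡x : fn ω* (star (inv ω) x) ≡ x
    fn*-star-inv≡x = begin
      fn ω* (star (inv ω) x)                    ≡⟨ ω*≗star (star (inv ω) x) ⟩
      + 1 - fn ω (+ 1 - star (inv ω) x)         ≡⟨ cong (λ z → + 1 - fn ω z) (1-[1-a]≡a (inv ω (+ 1 - x))) ⟩
      + 1 - fn ω (inv ω (+ 1 - x))              ≡⟨ cong (λ z → + 1 - z) (fn-inv ω (+ 1 - x)) ⟩
      + 1 - (+ 1 - x)                           ≡⟨ 1-[1-a]≡a x ⟩
      x                                         ∎

  inv-star-reflect : ∀ {i} → i ℕ.≤ n → inv ω* (+ (suc n ∸ i)) ≡ + suc n - inv ω (+ i)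
  inv-star-reflect {i} i≤n = begin
    inv ω* (+ (suc n ∸ i))              ≡⟨ inv-star (+ (suc n ∸ i)) ⟩
    + 1 - inv ω (+ 1 - + (suc n ∸ i))   ≡⟨ cong (λ z → + 1 - inv ω (+ 1 - z)) (+[m∸n]≡+m-+n (ℕₚ.m≤n⇒m≤1+n i≤n)) ⟩
    + 1 - inv ω (+ 1 - (+ suc n - + i)) ≡⟨ cong (λ z → + 1 - inv ω z) (1-[1+N-I]≡I-N (+ n) (+ i)) ⟩
    + 1 - inv ω (+ i - + n)             ≡⟨ cong (λ z → + 1 - z) (inv-periodic ω (+ i)) ⟩
    + 1 - (inv ω (+ i) - + n)           ≡⟨ 1-[a-N]≡1+N-a (inv ω (+ i)) (+ n) ⟩
    + suc n - inv ω (+ i)               ∎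
    where
    1-[1+N-I]≡I-N : ∀ N I → + 1 - (+ 1 + N - I) ≡ I - N
    1-[1+N-I]≡I-N = solve-∀
    1-[a-N]≡1+N-a : ∀ a N → + 1 - (a - N) ≡ + 1 + N - a
    1-[a-N]≡1+N-a = solve-∀

  module _ .{{_ : NonZero n}} where

    kval-reflect : ∀ {i j} → i ℕ.≤ n → j ℕ.≤ n → kval ω* (suc n ∸ j) (suc n ∸ i) ≡ kval ω i j
    kval-reflect {i} {j} i≤n j≤n = cong (λ d → ∣ d /ℕ n ∣) (begin
      inv ω* (+ (suc n ∸ i)) - inv ω* (+ (suc n ∸ j))
        ≡⟨ cong₂ _-_ (inv-star-reflect i≤n) (inv-star-reflect j≤n) ⟩
      (+ suc n - inv ω (+ i)) - (+ suc n - inv ω (+ j))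
        ≡⟨ [c-a]-[c-b]≡b-a (+ suc n) (inv ω (+ i)) (inv ω (+ j)) ⟩
      inv ω (+ j) - inv ω (+ i) ∎)
      where
      [c-a]-[c-b]≡b-a : ∀ c a b → (c - a) - (c - b) ≡ b - a
      [c-a]-[c-b]≡b-a = solve-∀

    sval-reflect : ∀ {i} → i ℕ.≤ n → + sval ω* (suc n ∸ i) ≡ + suc n - + sval ω i
    sval-reflect i≤n = trans (cong (λ a → + residue n a) (inv-star-reflect i≤n))
                             (residue-reflect n (inv ω (+ _)))

shiLow : (n r : ℕ) → ℤ → ℤ → Bool
shiLow n r sᵢ sⱼ = ⌊ (+ r + sᵢ) <? sⱼ ⌋ ∨ (⌊ (sᵢ + + r - + n) <? sⱼ ⌋ ∧ ⌊ sⱼ <? sᵢ ⌋)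

shiEntry : (n m r : ℕ) → ℤ → ℤ → ℕ → ℕ
shiEntry n m r sᵢ sⱼ k = if shiLow n r sᵢ sⱼ then k ℕ.⊓ m else k ℕ.⊓ suc m

-- Each comparison is translated by c - sᵢ - sⱼ.
shiLow-reflect : ∀ n r c sᵢ sⱼ → shiLow n r (c - sⱼ) (c - sᵢ) ≡ shiLow n r sᵢ sⱼ
shiLow-reflect n r c sᵢ sⱼ = cong₂ _∨_
  (⌊<?⌋-translate (+ r + sᵢ) sⱼ d (r+[c-b]≡r+a+d (+ r) sᵢ sⱼ c) (c-a≡b+d sᵢ sⱼ c))
  (cong₂ _∧_
    (⌊<?⌋-translate (sᵢ + + r - + n) sⱼ d (c-b+r-n≡a+r-n+d (+ r) (+ n) sᵢ sⱼ c) (c-a≡b+d sᵢ sⱼ c))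
    (⌊<?⌋-translate sⱼ sᵢ d (c-a≡b+d sᵢ sⱼ c) (c-b≡a+d sᵢ sⱼ c)))
  where
  d = c - sᵢ - sⱼ
  r+[c-b]≡r+a+d : ∀ r a b c → r + (c - b) ≡ r + a + (c - a - b)
  r+[c-b]≡r+a+d = solve-∀
  c-b+r-n≡a+r-n+d : ∀ r n a b c → c - b + r - n ≡ a + r - n + (c - a - b)
  c-b+r-n≡a+r-n+d = solve-∀
  c-a≡b+d : ∀ a b c → c - a ≡ b + (c - a - b)
  c-a≡b+d = solve-∀
  c-b≡a+d : ∀ a b c → c - b ≡ a + (c - a - b)
  c-b≡a+d = solve-∀

shiEntry-reflect : ∀ n m r c sᵢ sⱼ k → shiEntry n m r (c - sⱼ) (c - sᵢ) k ≡ shiEntry n m r sᵢ sⱼ k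
shiEntry-reflect n m r c sᵢ sⱼ k =
  cong (λ b → if b then k ℕ.⊓ m else k ℕ.⊓ suc m) (shiLow-reflect n r c sᵢ sⱼ)

proposition2p9 : (n p : ℕ) .{{_ : NonZero n}} → 1 ≤ p → Coprime n p →
    (ω ω* : AffinePerm n) → (∀ (i : ℤ) → fn ω* i ≡ star (fn ω) i) →
    Dominant ω → Stable p ω →
    ∀ (i j : ℕ) → 1 ≤ i → i < j → j ≤ n →
    shiT p ω* (suc n ∸ j) (suc n ∸ i) ≡ shiT p ω i j
proposition2p9 n p _ _ ω ω* ω*≗star _ _ i j _ i<j j≤n = begin
  shiT p ω* (suc n ∸ j) (suc n ∸ i)
    ≡⟨⟩
  shiEntry n m r (+ sval ω* (suc n ∸ j)) (+ sval ω* (suc n ∸ i)) (kval ω* (suc n ∸ j) (suc n ∸ i))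
    ≡⟨ cong₂ (λ sᵢ* sⱼ* → shiEntry n m r sᵢ* sⱼ* (kval ω* (suc n ∸ j) (suc n ∸ i)))
             (sval-reflect ω ω* ω*≗star j≤n) (sval-reflect ω ω* ω*≗star i≤n) ⟩
  shiEntry n m r (+ suc n - + sval ω j) (+ suc n - + sval ω i) (kval ω* (suc n ∸ j) (suc n ∸ i))
    ≡⟨ cong (shiEntry n m r (+ suc n - + sval ω j) (+ suc n - + sval ω i)) (kval-reflect ω ω* ω*≗star i≤n j≤n) ⟩
  shiEntry n m r (+ suc n - + sval ω j) (+ suc n - + sval ω i) (kval ω i j)
    ≡⟨ shiEntry-reflect n m r (+ suc n) (+ sval ω i) (+ sval ω j) (kval ω i j) ⟩
  shiT p ω i j
    ∎
  where
  open ≡-Reasoning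
  m = p ℕ./ n
  r = p ℕ.% n
  i≤n : i ℕ.≤ n
  i≤n = ℕₚ.≤-trans (ℕₚ.<⇒≤ i<j) j≤n
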